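{- Let $w$ be a word with smallest period $p$, and let $C_1=(a_1,b_1,p)$ and $C_2=(a_2,b_2,p)$ be two (not necessarily distinct) increasing clusters of occurrences of $w$ in $S[1\ldots n]$. Let $w_1=S[s_1\ldots e_1]$ be an occurrence of $w$ implied by $C_1$ and $w_2=S[s_2\ldots e_2]$ an occurrence implied by $C_2$. Then: (1) if $r_p(w_1)>r_p(w_2)$, then $S[s_1\ldots n]<_L S[s_2\ldots n]$; (2) if $r_p(w_1)=r_p(w_2)$ and $Tail(C_1)<_L Tail(C_2)$, then $S[s_1\ldots n]<_L S[s_2\ldots n]$.
   Context: $S$ is a string over an ordered alphabet, $<_L$ lexicographic order. A cluster $C=(a,b,p)$ of occurrences of $w$ is a maximal arithmetic progression with difference $p=per(w)$ of starting positions of occurrences of $w$ in $S$ (no occurrence at $a-p$ or $b+p$); it implies the occurrences $w_t=S[s_t\ldots e_t]$, $s_t=a+tp$, $t\in[0\ldots|C|-1]$. Let $w_s$ be the suffix of length $p$ of $w$. The period rank $r_p(w_t)$ of an occurrence $w_t=S[s_t\ldots e_t]$ is the maximal integer $x\ge0$ such that $S[e_t+1\ldots e_t+p\cdot x]=(w_s)^x$ (it equals $|C|-t-1$). $Tail(C)=S[e_{|C|-1}+1\ldots n]$. $C$ is increasing if $Tail(C)>_L w_s$. -}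

module Defs where

open import Level using (Level)
open import Data.Nat using (ℕ; zero; suc; _+_; _*_; _∸_; _≤_; _<_)
open import Data.Product using (Σ; _×_; _,_)
open import Data.List using (List; []; _∷_; _++_; length; drop; concat; replicate)
open import Relation.Binary.PropositionalEquality using (_≡_)
open import Relation.Binary.Core using (Rel)
open import Relation.Nullary using (¬_)
open import Data.List.Relation.Binary.Lex.Strict using (Lex-<)

-- Conventions: strings are lists, positions are 0-based.
-- An occurrence S[s .. e] (1-based, inclusive) corresponds here to the
-- 0-based start s and the exclusive end  s + length w.
-- The suffix S[s .. n] is  drop s S.

Implied : ℕ → ℕ → ℕ → ℕ → Set
Implied a b p s = Σ ℕ λ t → (s ≡ a + t * p) × (s ≤ b)

module _ {A : Set} where

  Prefix : List A → List A → Set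
  Prefix u v = Σ (List A) (λ r → u ++ r ≡ v)

  OccAt : List A → List A → ℕ → Set
  OccAt S w i = Prefix w (drop i S)

  -- p is a period of w (0 < p ≤ |w| and w[j] = w[j+p] for all valid j),
  -- expressed as: drop p w is a prefix of w.
  IsPeriod : List A → ℕ → Set
  IsPeriod w p = (0 < p) × (p ≤ length w) × Prefix (drop p w) w

  IsSmallestPeriod : List A → ℕ → Set
  IsSmallestPeriod w p = IsPeriod w p × (∀ q → IsPeriod w q → p ≤ q)

  suffixOfLen : ℕ → List A → List A
  suffixOfLen p w = drop (length w ∸ p) w

  -- C = (a , b , p) is a cluster of occurrences of w in S:
  -- a maximal arithmetic progression a, a+p, ..., b = a + m p of
  -- occurrence starts (no occurrence at a - p nor at b + p).
  Cluster : List A → List A → ℕ → ℕ → ℕ → Set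
  Cluster S w a b p =
    Σ ℕ λ m →
      (b ≡ a + m * p)
    × (∀ t → t ≤ m → OccAt S w (a + t * p))
    × ¬ (Σ ℕ λ a' → (a' + p ≡ a) × OccAt S w a')
    × ¬ OccAt S w (b + p)

  Tail : List A → List A → ℕ → List A
  Tail S w b = drop (b + length w) S

  IsPeriodRank : List A → List A → ℕ → ℕ → ℕ → Set
  IsPeriodRank S w p s x =
      Prefix (concat (replicate x (suffixOfLen p w))) (drop (s + length w) S)
    × ¬ Prefix (concat (replicate (suc x) (suffixOfLen p w))) (drop (s + length w) S)

  module _ (_≺_ : Rel A Level.zero) where
    _<L_ : List A → List A → Set
    _<L_ = Lex-< _≡_ _≺_

    Increasing : List A → List A → ℕ → ℕ → Set
    Increasing S w b p = suffixOfLen p w <L Tail S w b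

-- After an occurrence w_t of a cluster C come exactly r_p(w_t) copies of w_s and then Tail(C),
-- so S[s_t .. n] = w (w_s)^r Tail(C), and Tail(C) does not start with w_s (else C would extend).
-- Both suffixes start with w; the one with the smaller rank then shows Tail(C) where the other
-- still shows w_s, and Tail(C) >_L w_s decides. For equal ranks the tails decide.
module Submission where

open import Defs
open import Level using (0ℓ)
open import Data.Nat using (ℕ; zero; suc; _+_; _*_; _∸_; _≤_; _<_; s≤s; z≤n; NonZero; >-nonZero)
open import Data.Nat.Properties
  using (≤-refl; +-identityʳ; +-assoc; *-distribʳ-+; +-monoʳ-≤; +-cancelˡ-≤; *-cancelʳ-≤; m+[n∸m]≡n)
open import Data.Product using (_×_; _,_)
open import Data.List using (List; []; _∷_; _++_; length; drop; concat; replicate)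
open import Data.List.Properties using (++-assoc; ++-cancelˡ; ++-identityʳ; length-drop; drop-drop)
open import Data.List.Relation.Binary.Lex.Core using (this; next)
open import Relation.Binary.PropositionalEquality
open import Relation.Binary.Core using (Rel)
open import Relation.Binary.Structures using (IsStrictTotalOrder)
open import Relation.Nullary using (¬_)
open import Data.Empty using (⊥-elim)

module _ {A : Set} where

  _^_ : List A → ℕ → List A
  u ^ k = concat (replicate k u)

  drop-++-≤ : ∀ n (xs ys : List A) → n ≤ length xs → drop n (xs ++ ys) ≡ drop n xs ++ ys
  drop-++-≤ zero    xs       ys _         = refl
  drop-++-≤ (suc n) (x ∷ xs) ys (s≤s n≤) = drop-++-≤ n xs ys n≤

  drop-length-++ : ∀ (xs ys : List A) → drop (length xs) (xs ++ ys) ≡ ys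
  drop-length-++ []       ys = refl
  drop-length-++ (x ∷ xs) ys = drop-length-++ xs ys

  Prefix-++⁻ : ∀ (u v y : List A) → Prefix (u ++ v) (u ++ y) → Prefix v y
  Prefix-++⁻ u v y (r , eq) = r , ++-cancelˡ u _ _ (trans (sym (++-assoc u v r)) eq)

  Prefix-++⁺ : ∀ (u v y : List A) → Prefix v y → Prefix (u ++ v) (u ++ y)
  Prefix-++⁺ u v y (r , eq) = r , trans (++-assoc u v r) (cong (u ++_) eq)

  maximal-prefix-power-unique : ∀ (u T : List A) → ¬ Prefix u T → ∀ x k →
    Prefix (u ^ x) (u ^ k ++ T) → ¬ Prefix (u ^ suc x) (u ^ k ++ T) → x ≡ k
  maximal-prefix-power-unique u T u⋢T zero zero _ _ = refl
  maximal-prefix-power-unique u T u⋢T zero (suc k) _ not-u =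
    ⊥-elim (not-u (subst (λ z → Prefix z (u ^ suc k ++ T)) (sym (++-identityʳ u))
      (u ^ k ++ T , sym (++-assoc u (u ^ k) T))))
  maximal-prefix-power-unique u T u⋢T (suc x) zero (r , eq) _ =
    ⊥-elim (u⋢T (u ^ x ++ r , trans (sym (++-assoc u _ r)) eq))
  maximal-prefix-power-unique u T u⋢T (suc x) (suc k) ux ¬ux+1 =
    cong suc (maximal-prefix-power-unique u T u⋢T x k
      (Prefix-++⁻ u _ _ (subst (Prefix (u ++ u ^ x)) (++-assoc u (u ^ k) T) ux))
      (λ h → ¬ux+1 (subst (Prefix (u ++ u ^ suc x)) (sym (++-assoc u (u ^ k) T)) (Prefix-++⁺ u _ _ h))))

  module _ (_≺_ : Rel A 0ℓ) where

    Lex-<-++ : ∀ (xs ys zs : List A) → _<L_ _≺_ ys zs → _<L_ _≺_ (xs ++ ys) (xs ++ zs)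
    Lex-<-++ []       ys zs lt = lt
    Lex-<-++ (x ∷ xs) ys zs lt = next refl (Lex-<-++ xs ys zs lt)

    Lex-<-non-prefix-++ : ∀ (u T : List A) → _<L_ _≺_ u T → ¬ Prefix u T →
                          ∀ z → _<L_ _≺_ (u ++ z) T
    Lex-<-non-prefix-++ []      T       _              u⋢T z = ⊥-elim (u⋢T (T , refl))
    Lex-<-non-prefix-++ (x ∷ u) (y ∷ T) (this x≺y)     u⋢T z = this x≺y
    Lex-<-non-prefix-++ (x ∷ u) (y ∷ T) (next refl lt) u⋢T z =
      next refl (Lex-<-non-prefix-++ u T lt (λ { (r , eq) → u⋢T (r , cong (x ∷_) eq) }) z)

    Lex-<-higher-power : ∀ (u T : List A) → _<L_ _≺_ u T → ¬ Prefix u T →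
                         ∀ {r₁ r₂} → r₂ < r₁ → ∀ X → _<L_ _≺_ (u ^ r₁ ++ X) (u ^ r₂ ++ T)
    Lex-<-higher-power u T u<T u⋢T {suc r₁} {zero} _ X =
      subst (λ z → _<L_ _≺_ z T) (sym (++-assoc u (u ^ r₁) X)) (Lex-<-non-prefix-++ u T u<T u⋢T _)
    Lex-<-higher-power u T u<T u⋢T {suc r₁} {suc r₂} (s≤s r₂<r₁) X =
      subst₂ (_<L_ _≺_) (sym (++-assoc u (u ^ r₁) X)) (sym (++-assoc u (u ^ r₂) T))
        (Lex-<-++ u _ _ (Lex-<-higher-power u T u<T u⋢T r₂<r₁ X))

  period-decomposition : ∀ {w : List A} {p} → IsPeriod w p → w ≡ drop p w ++ suffixOfLen p w
  period-decomposition {w} {p} (_ , _ , v , pv) = trans (sym pv) (cong (drop p w ++_) (sym u≡v))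
    where
      open ≡-Reasoning
      u≡v : suffixOfLen p w ≡ v
      u≡v = begin
        drop (length w ∸ p) w                            ≡⟨ cong (drop (length w ∸ p)) (sym pv) ⟩
        drop (length w ∸ p) (drop p w ++ v)              ≡⟨ cong (λ n → drop n (drop p w ++ v)) (sym (length-drop p w)) ⟩
        drop (length (drop p w)) (drop p w ++ v)         ≡⟨ drop-length-++ (drop p w) v ⟩
        v                                                ∎

  module Occurrences (S w : List A) (p : ℕ) (period : IsPeriod w p) where

    private
      L = length w
      u = suffixOfLen p w
      p≤L : p ≤ L
      p≤L = let (_ , p≤L , _) = period in p≤L
      w≡ : w ≡ drop p w ++ u
      w≡ = period-decomposition period

    OccRun : ℕ → ℕ → Set
    OccRun x k = ∀ j → j ≤ k → OccAt S w (x + j * p)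

    drop-after-occurrence : ∀ x {r} → w ++ r ≡ drop x S → drop (x + L) S ≡ r
    drop-after-occurrence x {r} eq =
      trans (sym (drop-drop x L S)) (trans (cong (drop L) (sym eq)) (drop-length-++ w r))

    drop-at-occurrence : ∀ x → OccAt S w x → drop x S ≡ w ++ drop (x + L) S
    drop-at-occurrence x (r , occ) = trans (sym occ) (cong (w ++_) (sym (drop-after-occurrence x occ)))

    drop-period-after-occurrence : ∀ x {r} → w ++ r ≡ drop x S → drop (x + p) S ≡ drop p w ++ r
    drop-period-after-occurrence x {r} eq =
      trans (sym (drop-drop x p S)) (trans (cong (drop p) (sym eq)) (drop-++-≤ p w r p≤L))

    consecutive-occurrences : ∀ x → OccAt S w x → OccAt S w (x + p) →
                              drop (x + L) S ≡ u ++ drop (x + p + L) S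
    consecutive-occurrences x (r , occ) (r′ , occ′) = begin
      drop (x + L) S           ≡⟨ drop-after-occurrence x occ ⟩
      r                        ≡⟨ ++-cancelˡ (drop p w) _ _ (begin
          drop p w ++ r            ≡⟨ sym (drop-period-after-occurrence x occ) ⟩
          drop (x + p) S           ≡⟨ sym occ′ ⟩
          w ++ r′                  ≡⟨ cong (_++ r′) w≡ ⟩
          (drop p w ++ u) ++ r′    ≡⟨ ++-assoc (drop p w) u r′ ⟩
          drop p w ++ (u ++ r′)    ∎) ⟩
      u ++ r′                  ≡⟨ cong (u ++_) (sym (drop-after-occurrence (x + p) occ′)) ⟩
      u ++ drop (x + p + L) S  ∎
      where open ≡-Reasoning

    occurrence-extends : ∀ x → OccAt S w x → Prefix u (drop (x + L) S) → OccAt S w (x + p)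
    occurrence-extends x (r , occ) (r′ , u⊑) = r′ , (begin
      w ++ r′                  ≡⟨ cong (_++ r′) w≡ ⟩
      (drop p w ++ u) ++ r′    ≡⟨ ++-assoc (drop p w) u r′ ⟩
      drop p w ++ (u ++ r′)    ≡⟨ cong (drop p w ++_) (trans u⊑ (drop-after-occurrence x occ)) ⟩
      drop p w ++ r            ≡⟨ sym (drop-period-after-occurrence x occ) ⟩
      drop (x + p) S           ∎)
      where open ≡-Reasoning

    OccRun-start : ∀ x {k} → OccRun x k → OccAt S w x
    OccRun-start x occ = subst (OccAt S w) (+-identityʳ x) (occ 0 z≤n)

    OccRun-tail : ∀ x {k} → OccRun x (suc k) → OccRun (x + p) k
    OccRun-tail x occ j j≤k = subst (OccAt S w) (sym (+-assoc x p (j * p))) (occ (suc j) (s≤s j≤k))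

    drop-after-OccRun : ∀ k x → OccRun x k → drop (x + L) S ≡ u ^ k ++ drop (x + k * p + L) S
    drop-after-OccRun zero    x _   = cong (λ y → drop (y + L) S) (sym (+-identityʳ x))
    drop-after-OccRun (suc k) x occ = begin
      drop (x + L) S                              ≡⟨ consecutive-occurrences x (OccRun-start x occ)
                                                       (OccRun-start (x + p) (OccRun-tail x occ)) ⟩
      u ++ drop (x + p + L) S                     ≡⟨ cong (u ++_) (drop-after-OccRun k (x + p) (OccRun-tail x occ)) ⟩
      u ++ (u ^ k ++ drop (x + p + k * p + L) S)  ≡⟨ sym (++-assoc u (u ^ k) _) ⟩
      u ^ suc k ++ drop (x + p + k * p + L) S     ≡⟨ cong (λ y → u ^ suc k ++ drop (y + L) S) (+-assoc x p (k * p)) ⟩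
      u ^ suc k ++ drop (x + suc k * p + L) S     ∎
      where open ≡-Reasoning

    progression-+ : ∀ a t j → a + t * p + j * p ≡ a + (t + j) * p
    progression-+ a t j = trans (+-assoc a (t * p) (j * p)) (cong (a +_) (sym (*-distribʳ-+ p t j)))

    Tail-non-prefix : ∀ {a b} → Cluster S w a b p → ¬ Prefix u (Tail S w b)
    Tail-non-prefix {a} (m , refl , occ , _ , no-right) u⊑ = no-right (occurrence-extends (a + m * p) (occ m ≤-refl) u⊑)

    -- The run s, s + p, ..., b puts u ^ (m ∸ t) after w; as Tail does not start with u,
    -- that exponent is the rank.
    drop-at-implied : ∀ {a b s} r → Cluster S w a b p → Implied a b p s → IsPeriodRank S w p s r →
                      drop s S ≡ w ++ (u ^ r ++ Tail S w b)
    drop-at-implied {a} {s = s} r cluster@(m , refl , occ , _ , _) (t , refl , s≤b) (u^r⊑ , ¬u^r+1⊑) = begin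
      drop s S              ≡⟨ drop-at-occurrence s (OccRun-start s run) ⟩
      w ++ drop (s + L) S   ≡⟨ cong (w ++_) after-s ⟩
      w ++ (u ^ k ++ T)     ≡⟨ cong (λ z → w ++ (u ^ z ++ T)) (sym r≡k) ⟩
      w ++ (u ^ r ++ T)     ∎
      where
        open ≡-Reasoning
        instance
          p≢0 : NonZero p
          p≢0 = let (0<p , _) = period in >-nonZero 0<p
        t≤m : t ≤ m
        t≤m = *-cancelʳ-≤ t m p (+-cancelˡ-≤ a _ _ s≤b)
        k = m ∸ t
        T = Tail S w (a + m * p)
        run : OccRun s k
        run j j≤k = subst (OccAt S w) (sym (progression-+ a t j))
          (occ (t + j) (subst (t + j ≤_) (m+[n∸m]≡n t≤m) (+-monoʳ-≤ t j≤k)))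
        after-s : drop (s + L) S ≡ u ^ k ++ T
        after-s = trans (drop-after-OccRun k s run)
          (cong (λ y → u ^ k ++ drop (y + L) S) (trans (progression-+ a t k) (cong (λ n → a + n * p) (m+[n∸m]≡n t≤m))))
        r≡k : r ≡ k
        r≡k = maximal-prefix-power-unique u T (Tail-non-prefix cluster) r k
          (subst (Prefix _) after-s u^r⊑) (λ h → ¬u^r+1⊑ (subst (Prefix _) (sym after-s) h))

mainTheorem15 : {A : Set} (_≺_ : Rel A 0ℓ) → IsStrictTotalOrder _≡_ _≺_ →
    (S w : List A) (p : ℕ) → IsSmallestPeriod w p →
    (a₁ b₁ a₂ b₂ : ℕ) → Cluster S w a₁ b₁ p → Cluster S w a₂ b₂ p →
    Increasing _≺_ S w b₁ p → Increasing _≺_ S w b₂ p →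
    (s₁ s₂ : ℕ) → Implied a₁ b₁ p s₁ → Implied a₂ b₂ p s₂ →
    (r₁ r₂ : ℕ) → IsPeriodRank S w p s₁ r₁ → IsPeriodRank S w p s₂ r₂ →
    (r₂ < r₁ → _<L_ _≺_ (drop s₁ S) (drop s₂ S))
    × (r₁ ≡ r₂ → _<L_ _≺_ (Tail S w b₁) (Tail S w b₂) →
         _<L_ _≺_ (drop s₁ S) (drop s₂ S))
mainTheorem15 _≺_ _ S w p (period , _) a₁ b₁ a₂ b₂ C₁ C₂ _ increasing₂ s₁ s₂ i₁ i₂ r₁ r₂ rank₁ rank₂ =
  (λ r₂<r₁ → compare (Lex-<-higher-power _≺_ u (Tail S w b₂) increasing₂ (Tail-non-prefix C₂) r₂<r₁ _))
  , λ { refl T₁<T₂ → compare (Lex-<-++ _≺_ (u ^ r₁) _ _ T₁<T₂) }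
  where
    open Occurrences S w p period
    u = suffixOfLen p w
    compare : _<L_ _≺_ (u ^ r₁ ++ Tail S w b₁) (u ^ r₂ ++ Tail S w b₂) → _<L_ _≺_ (drop s₁ S) (drop s₂ S)
    compare lt = subst₂ (_<L_ _≺_) (sym (drop-at-implied r₁ C₁ i₁ rank₁)) (sym (drop-at-implied r₂ C₂ i₂ rank₂))
      (Lex-<-++ _≺_ w _ _ lt)
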